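{- For every integer $g \geq 5$, $f(1,2,g) = 2g$. That is, the minimum order of a mixed graph in which every vertex is incident with exactly $1$ edge, has out-degree exactly $2$, and which has girth $g$, equals $2g$.
   Context: A mixed graph $G$ is a finite graph having both undirected edges (called edges) and directed edges (called arcs). The degree of a vertex is the number of edges incident with it; its out-degree (resp. in-degree) is the number of arcs directed from (resp. to) it. A cycle in a mixed graph is a sequence of vertices $v_0, v_1, \dots, v_k$ with $v_0 = v_k$ such that each consecutive pair $v_i, v_{i+1}$ is joined either by an edge or by an arc directed from $v_i$ to $v_{i+1}$, and no edge or arc is used more than once; its length is $k$. The girth is the length of a shortest cycle. An $(r,z,g)$-graph is a mixed graph in which every vertex has degree $r$ and out-degree $z$, and which has girth $g$. $f(r,z,g)$ denotes the minimum order of an $(r,z,g)$-graph. -}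

module Defs where

open import Data.Nat using (ℕ; zero; suc; _+_; _≤_; _<_)
open import Data.Bool using (Bool; true; false)
open import Data.Fin using (Fin; zero; suc; inject₁; fromℕ)
open import Data.Sum using (_⊎_; inj₁; inj₂)
open import Data.Product using (_×_; Σ; ∃; _,_)
open import Relation.Binary.PropositionalEquality using (_≡_; _≢_)
open import Relation.Nullary using (¬_)
open import Data.Empty using (⊥)

countTrue : ∀ {n} → (Fin n → Bool) → ℕ
countTrue {zero}  p = 0
countTrue {suc n} p with p zero
... | true  = suc (countTrue (λ i → p (suc i)))
... | false = countTrue (λ i → p (suc i))

-- A (simple) mixed graph on vertex set Fin n:
--   edge u v : undirected edge between u and v (symmetric, loopless)
--   arc  u v : arc directed from u to v (loopless)
record MixedGraph (n : ℕ) : Set where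
  field
    edge      : Fin n → Fin n → Bool
    arc       : Fin n → Fin n → Bool
    edge-sym  : ∀ u v → edge u v ≡ edge v u
    edge-irr  : ∀ u → edge u u ≡ false
    arc-irr   : ∀ u → arc u u ≡ false
open MixedGraph public

degree : ∀ {n} → MixedGraph n → Fin n → ℕ
degree G u = countTrue (edge G u)

outDegree : ∀ {n} → MixedGraph n → Fin n → ℕ
outDegree G u = countTrue (arc G u)

Step : ∀ {n} → MixedGraph n → Fin n → Fin n → Set
Step G u v = (edge G u v ≡ true) ⊎ (arc G u v ≡ true)

SameUse : ∀ {n} (G : MixedGraph n) {a b c d : Fin n} → Step G a b → Step G c d → Set
SameUse G {a} {b} {c} {d} (inj₁ _) (inj₁ _) = ((a ≡ c) × (b ≡ d)) ⊎ ((a ≡ d) × (b ≡ c))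
SameUse G {a} {b} {c} {d} (inj₂ _) (inj₂ _) = (a ≡ c) × (b ≡ d)
SameUse G (inj₁ _) (inj₂ _) = ⊥
SameUse G (inj₂ _) (inj₁ _) = ⊥

record Cycle {n} (G : MixedGraph n) (k : ℕ) : Set where
  field
    nontrivial : 1 ≤ k
    vert       : Fin (suc k) → Fin n
    closed     : vert zero ≡ vert (fromℕ k)
    step       : (i : Fin k) → Step G (vert (inject₁ i)) (vert (suc i))
    no-repeat  : (i j : Fin k) → i ≢ j → ¬ SameUse G (step i) (step j)

HasGirth : ∀ {n} → MixedGraph n → ℕ → Set
HasGirth G g = Cycle G g × (∀ k → k < g → ¬ Cycle G k)

IsRZGGraph : ∀ {n} → MixedGraph n → ℕ → ℕ → ℕ → Set
IsRZGGraph G r z g = (∀ u → degree G u ≡ r) × (∀ u → outDegree G u ≡ z) × HasGirth G g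

MinOrder : ℕ → ℕ → ℕ → ℕ → Set
MinOrder r z g m =
  (Σ (MixedGraph m) λ G → IsRZGGraph G r z g)
  × (∀ n (G : MixedGraph n) → IsRZGGraph G r z g → m ≤ n)

-- Degree 1 makes the edges a perfect matching u ↦ partner u. Grow a directed path
-- w₁ → ⋯ → wₘ whose vertices and their partners are 2m distinct vertices, so 2m ≤ n. At most one of
-- the two out-neighbours of wₘ is partner w₁; take the other. If it is new, the path grows; otherwise
-- it is some wₛ, closing a cycle of arcs, or partner wₛ with s > 1, closing a cycle through the edge
-- partner wₛ — wₛ. Either cycle has length at most m, so some cycle has length at most n/2 and 2g ≤ n.
--
-- On {0,1} × ℤ/g join (ε, i) — (1 − ε, i) and add arcs (ε, i) → (ε′, i + 1). Edges keep
-- the index and arcs raise it by one, so g divides the number of arcs of every cycle; that number is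
-- not 0 since a cycle cannot use two consecutive edges of a matching. Hence every cycle has length at least g,
-- and i ↦ (0, i) is a cycle of length g.

module Submission where

open import Defs
open import Data.Nat using (ℕ; zero; suc; _+_; _∸_; _*_; _%_; _/_; _≤_; _<_; z≤n; s≤s; s≤s⁻¹; z<s; s<s;
                            NonZero; >-nonZero; ≢-nonZero)
open import Data.Nat.Properties
  using (suc-injective; +-comm; +-assoc; +-suc; +-identityʳ; +-cancelˡ-≡; +-∸-assoc; m∸n≤m; n∸n≡0; ∸-cancelˡ-≡;
         ≤-trans; <-trans; ≤-<-trans; <⇒≤; <⇒≱; ≮⇒≥; n<1+n; m≤m+n; m≤n⇒m≤1+n; m≤n⇒m<n∨m≡n; *-monoʳ-≤;
         anyUpTo?)
open import Data.Nat.DivMod using (_mod_; m≡m%n+[m/n]*n; %-distribˡ-+; m<n⇒m%n≡m; n%n≡0)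
open import Data.Nat.Divisibility using (_∣_; ∣m+n∣m⇒∣n; n∣m*n; ∣⇒≤)
open import Data.Bool using (Bool; true; false)
open import Data.Fin using (Fin; zero; suc; toℕ; inject₁; fromℕ; _↑ˡ_; _↑ʳ_; _≟_; combine; remQuot; quotient; remainder)
import Data.Fin.Properties as Fin
open import Data.Sum using (_⊎_; inj₁; inj₂)
open import Data.Product using (Σ; _×_; _,_; proj₁; proj₂; uncurry)
open import Data.Empty using (⊥)
open import Function using (_∘_)
open import Function.Bundles using (mk⇔)
open import Relation.Binary.PropositionalEquality
open import Relation.Nullary using (¬_; Dec; yes; no; does; contradiction)
open import Relation.Nullary.Decidable using (dec-true; dec-false; does-⇔)

countTrue-none : ∀ {n} {p : Fin n → Bool} → (∀ i → p i ≡ false) → countTrue p ≡ 0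
countTrue-none {zero}        _    = refl
countTrue-none {suc n} {p} none with p zero | none zero
... | .false | refl = countTrue-none (none ∘ suc)

countTrue-unique : ∀ {n} {p : Fin n → Bool} (w : Fin n) → p w ≡ true → (∀ i → i ≢ w → p i ≡ false) →
                   countTrue p ≡ 1
countTrue-unique {p = p} zero pw others with p zero | pw
... | .true | refl = cong suc (countTrue-none λ i → others (suc i) λ ())
countTrue-unique {p = p} (suc w) pw others with p zero | others zero (λ ())
... | .false | refl = countTrue-unique w pw λ i i≢w → others (suc i) (i≢w ∘ Fin.suc-injective)

countTrue-≤ : ∀ {n} (p : Fin n → Bool) → countTrue p ≤ n
countTrue-≤ {zero}  p = z≤n
countTrue-≤ {suc n} p with p zero
... | true  = s≤s (countTrue-≤ (p ∘ suc))
... | false = m≤n⇒m≤1+n (countTrue-≤ (p ∘ suc))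

countTrue-++ : ∀ m {k} (p : Fin (m + k) → Bool) →
               countTrue p ≡ countTrue (λ i → p (i ↑ˡ k)) + countTrue (λ i → p (m ↑ʳ i))
countTrue-++ zero    p = refl
countTrue-++ (suc m) p with p zero
... | true  = cong suc (countTrue-++ m (p ∘ suc))
... | false = countTrue-++ m (p ∘ suc)

countTrue≡0⇒false : ∀ {n} (p : Fin n → Bool) → countTrue p ≡ 0 → ∀ i → p i ≡ false
countTrue≡0⇒false {suc n} p c≡0 i with p zero in eq
countTrue≡0⇒false {suc n} p () i       | true
countTrue≡0⇒false {suc n} p c≡0 zero    | false = eq
countTrue≡0⇒false {suc n} p c≡0 (suc i) | false = countTrue≡0⇒false (p ∘ suc) c≡0 i

countTrue≡1⇒unique : ∀ {n} (p : Fin n → Bool) → countTrue p ≡ 1 →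
                     Σ (Fin n) λ w → p w ≡ true × (∀ i → p i ≡ true → i ≡ w)
countTrue≡1⇒unique {suc n} p c≡1 with p zero in eq
... | true  = zero , eq , unique
  where
  unique : ∀ i → p i ≡ true → i ≡ zero
  unique zero    _  = refl
  unique (suc i) pi with () ← trans (sym pi) (countTrue≡0⇒false (p ∘ suc) (suc-injective c≡1) i)
... | false with countTrue≡1⇒unique (p ∘ suc) c≡1
...   | w , pw , unique′ = suc w , pw , unique
  where
  unique : ∀ i → p i ≡ true → i ≡ suc w
  unique zero    p0 with () ← trans (sym p0) eq
  unique (suc i) pi = cong suc (unique′ i pi)

countTrue≡2⇒pair : ∀ {n} (p : Fin n → Bool) → countTrue p ≡ 2 →
                   Σ (Fin n) λ a → Σ (Fin n) λ b → a ≢ b × p a ≡ true × p b ≡ true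
countTrue≡2⇒pair {suc n} p c≡2 with p zero in eq
... | true with countTrue≡1⇒unique (p ∘ suc) (suc-injective c≡2)
...   | b , pb , _ = zero , suc b , (λ ()) , eq , pb
countTrue≡2⇒pair {suc n} p c≡2 | false with countTrue≡2⇒pair (p ∘ suc) c≡2
...   | a , b , a≢b , pa , pb = suc a , suc b , a≢b ∘ Fin.suc-injective , pa , pb

countTrue-cong : ∀ {n} {p q : Fin n → Bool} → p ≗ q → countTrue p ≡ countTrue q
countTrue-cong {zero}          _   = refl
countTrue-cong {suc n} {p} {q} p≗q with p zero | q zero | p≗q zero
... | true  | .true  | refl = cong suc (countTrue-cong (p≗q ∘ suc))
... | false | .false | refl = countTrue-cong (p≗q ∘ suc)

countTrue-2* : ∀ {k} (p : Fin 2 → Fin k → Bool) →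
               countTrue (uncurry p ∘ remQuot k) ≡ countTrue (p zero) + countTrue (p (suc zero))
countTrue-2* {k} p = begin
  countTrue f                                                  ≡⟨ countTrue-++ k f ⟩
  countTrue (onLayer zero) + countTrue (λ j → f (k ↑ʳ j))      ≡⟨ cong (countTrue (onLayer zero) +_)
                                                                      (countTrue-++ k {0} _) ⟩
  countTrue (onLayer zero) + (countTrue (onLayer (suc zero)) + 0)
    ≡⟨ cong₂ _+_ (onLayer-count zero) (trans (+-identityʳ _) (onLayer-count (suc zero))) ⟩
  countTrue (p zero) + countTrue (p (suc zero))                  ∎
  where
  open ≡-Reasoning
  f : Fin (2 * k) → Bool
  f = uncurry p ∘ remQuot k
  onLayer : Fin 2 → Fin k → Bool
  onLayer b j = f (combine b j)
  onLayer-count : ∀ b → countTrue (onLayer b) ≡ countTrue (p b)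
  onLayer-count b = countTrue-cong λ j → cong (uncurry p) (Fin.remQuot-combine b j)

module _ {d} .{{_ : NonZero d}} where

  %-+-congˡ : ∀ {m m′} n → m % d ≡ m′ % d → (m + n) % d ≡ (m′ + n) % d
  %-+-congˡ {m} {m′} n eq = begin
    (m + n) % d             ≡⟨ %-distribˡ-+ m n d ⟩
    (m % d + n % d) % d     ≡⟨ cong (λ r → (r + n % d) % d) eq ⟩
    (m′ % d + n % d) % d    ≡⟨ %-distribˡ-+ m′ n d ⟨
    (m′ + n) % d            ∎
    where open ≡-Reasoning

  [m+n]%d≡m%d⇒d∣n : ∀ m n → (m + n) % d ≡ m % d → d ∣ n
  [m+n]%d≡m%d⇒d∣n m n eq = ∣m+n∣m⇒∣n (subst (d ∣_) (sym q₀d+n≡q₁d) (n∣m*n q₁)) (n∣m*n q₀)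
    where
    open ≡-Reasoning
    q₀ q₁ : ℕ
    q₀ = m / d
    q₁ = (m + n) / d
    q₀d+n≡q₁d : q₀ * d + n ≡ q₁ * d
    q₀d+n≡q₁d = +-cancelˡ-≡ (m % d) _ _ (begin
      m % d + (q₀ * d + n)  ≡⟨ +-assoc (m % d) _ n ⟨
      m % d + q₀ * d + n    ≡⟨ cong (_+ n) (m≡m%n+[m/n]*n m d) ⟨
      m + n                 ≡⟨ m≡m%n+[m/n]*n (m + n) d ⟩
      (m + n) % d + q₁ * d  ≡⟨ cong (_+ q₁ * d) eq ⟩
      m % d + q₁ * d        ∎)

_∷_ : ∀ {A : Set} → A → (ℕ → A) → ℕ → A
(c ∷ w) zero    = c
(c ∷ w) (suc t) = w t

module _ {n} {G : MixedGraph n} where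

  isArc : ∀ {u v} → Step G u v → Bool
  isArc (inj₁ _) = false
  isArc (inj₂ _) = true

  arcCount : ∀ {k} → Cycle G k → ℕ
  arcCount C = countTrue (λ i → isArc (Cycle.step C i))

  arcCount≤length : ∀ {k} (C : Cycle G k) → arcCount C ≤ k
  arcCount≤length C = countTrue-≤ (λ i → isArc (Cycle.step C i))

  sameUse-arcʳ : ∀ {a b c d} (s : Step G a b) (h : arc G c d ≡ true) → SameUse G s (inj₂ h) → a ≡ c
  sameUse-arcʳ (inj₂ _) _ (a≡c , _) = a≡c

  sameUse-arcˡ : ∀ {a b c d} (h : arc G a b ≡ true) (s : Step G c d) → SameUse G (inj₂ h) s → a ≡ c
  sameUse-arcˡ _ (inj₂ _) (a≡c , _) = a≡c

  edgeOf : ∀ {u v} (s : Step G u v) → isArc s ≡ false → edge G u v ≡ true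
  edgeOf (inj₁ e) _ = e

  sameUse-edges : ∀ {a b c} (s : Step G a b) (t : Step G b c) →
                  isArc s ≡ false → isArc t ≡ false → a ≡ c → SameUse G s t
  sameUse-edges (inj₁ _) (inj₁ _) _ _ a≡c = inj₂ (a≡c , refl)

  module _ (matching : ∀ {u v w} → edge G u v ≡ true → edge G u w ≡ true → v ≡ w) where

    edgesOnly⇒⊥ : ∀ {k} (C : Cycle G k) → (∀ i → isArc (Cycle.step C i) ≡ false) → ⊥
    edgesOnly⇒⊥ {zero}        C _ with () ← Cycle.nontrivial C
    edgesOnly⇒⊥ {suc zero}    C edges = contradiction (trans (sym (edge-irr G (vert zero))) loop) λ ()
      where
      open Cycle C
      loop : edge G (vert zero) (vert zero) ≡ true
      loop = subst (λ v → edge G (vert zero) v ≡ true) (sym closed) (edgeOf (step zero) (edges zero))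
    edgesOnly⇒⊥ {suc (suc k)} C edges =
      no-repeat zero (suc zero) (λ ()) (sameUse-edges (step zero) (step (suc zero)) e₀ e₁ v₀≡v₂)
      where
      open Cycle C
      e₀ : isArc (step zero) ≡ false
      e₀ = edges zero
      e₁ : isArc (step (suc zero)) ≡ false
      e₁ = edges (suc zero)
      v₀≡v₂ : vert zero ≡ vert (suc (suc zero))
      v₀≡v₂ = matching (trans (edge-sym G _ _) (edgeOf (step zero) e₀)) (edgeOf (step (suc zero)) e₁)

    arcCount≢0 : ∀ {k} (C : Cycle G k) → arcCount C ≢ 0
    arcCount≢0 C none = edgesOnly⇒⊥ C (countTrue≡0⇒false _ none)

  module _ (φ : Fin n → ℕ) (d : ℕ) .{{_ : NonZero d}}
           (edge-φ : ∀ {u v} → edge G u v ≡ true → φ v ≡ φ u)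
           (arc-φ : ∀ {u v} → arc G u v ≡ true → φ v % d ≡ suc (φ u) % d) where

    walk-winding : ∀ k (v : Fin (suc k) → Fin n) (st : ∀ i → Step G (v (inject₁ i)) (v (suc i))) →
                   (φ (v zero) + countTrue (λ i → isArc (st i))) % d ≡ φ (v (fromℕ k)) % d
    walk-winding zero    v st = cong (_% d) (+-identityʳ (φ (v zero)))
    walk-winding (suc k) v st with st zero | walk-winding k (v ∘ suc) (st ∘ suc)
    ... | inj₁ e | winding = trans (cong (λ x → (x + _) % d) (sym (edge-φ e))) winding
    ... | inj₂ a | winding = begin
      (φ (v zero) + suc r) % d    ≡⟨ cong (_% d) (+-suc (φ (v zero)) r) ⟩
      (suc (φ (v zero)) + r) % d  ≡⟨ %-+-congˡ r (arc-φ a) ⟨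
      (φ (v (suc zero)) + r) % d  ≡⟨ winding ⟩
      φ (v (fromℕ (suc k))) % d   ∎
      where
      open ≡-Reasoning
      r : ℕ
      r = countTrue (λ i → isArc (st (suc i)))

    d∣arcCount : ∀ {k} (C : Cycle G k) → d ∣ arcCount C
    d∣arcCount {k} C = [m+n]%d≡m%d⇒d∣n (φ (vert zero)) (arcCount C)
      (trans (walk-winding k vert step) (cong (λ v → φ v % d) (sym closed)))
      where open Cycle C

  -- The path visits w (m ∸ 1), …, w 1, w 0 in this order, so that it is extended at its end by c ∷ w.
  record ArcPath (m : ℕ) (w : ℕ → Fin n) : Set where
    field
      arcs     : ∀ {t} → suc t < m → arc G (w (suc t)) (w t) ≡ true
      distinct : ∀ {s t} → s < m → t < m → w s ≡ w t → s ≡ t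
  open ArcPath public

  ArcPath-≤ : ∀ {m m′ w} → m′ ≤ m → ArcPath m w → ArcPath m′ w
  ArcPath-≤ m′≤m P = record
    { arcs     = λ t<m′ → arcs P (≤-trans t<m′ m′≤m)
    ; distinct = λ s<m′ t<m′ → distinct P (≤-trans s<m′ m′≤m) (≤-trans t<m′ m′≤m)
    }

  ArcPath-∷ : ∀ {m w c} → ArcPath m w → arc G (w 0) c ≡ true → (∀ {t} → t < m → c ≢ w t) →
              ArcPath (suc m) (c ∷ w)
  ArcPath-∷ {m} {w} {c} P w₀→c c∉w = record { arcs = arcs′ ; distinct = distinct′ }
    where
    arcs′ : ∀ {t} → suc t < suc m → arc G ((c ∷ w) (suc t)) ((c ∷ w) t) ≡ true
    arcs′ {zero}  _         = w₀→c
    arcs′ {suc t} (s<s t<m) = arcs P t<m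
    distinct′ : ∀ {s t} → s < suc m → t < suc m → (c ∷ w) s ≡ (c ∷ w) t → s ≡ t
    distinct′ {zero}  {zero}  _         _         _  = refl
    distinct′ {zero}  {suc t} _         (s<s t<m) eq = contradiction eq (c∉w t<m)
    distinct′ {suc s} {zero}  (s<s s<m) _         eq = contradiction (sym eq) (c∉w s<m)
    distinct′ {suc s} {suc t} (s<s s<m) (s<s t<m) eq = cong suc (distinct P s<m t<m eq)

  -- The cycle starts at x 0, takes the closing step to x m and then follows the path back to x 0.
  closeArcPath : ∀ {m x} → ArcPath (suc m) x → Step G (x 0) (x m) → Cycle G (suc m)
  closeArcPath {m} {x} P closing = record
    { nontrivial = s≤s z≤n
    ; vert       = vert
    ; closed     = cong x (sym (trans (cong (m ∸_) (Fin.toℕ-fromℕ m)) (n∸n≡0 m)))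
    ; step       = step
    ; no-repeat  = no-repeat
    }
    where
    vert : Fin (suc (suc m)) → Fin n
    vert zero    = x 0
    vert (suc i) = x (m ∸ toℕ i)

    tail : Fin m → ℕ
    tail i = m ∸ toℕ (inject₁ i)

    tail≡suc : ∀ i → tail i ≡ suc (m ∸ suc (toℕ i))
    tail≡suc i = trans (cong (m ∸_) (Fin.toℕ-inject₁ i)) (+-∸-assoc 1 (Fin.toℕ<n i))

    tail<1+m : ∀ i → tail i < suc m
    tail<1+m i = s≤s (m∸n≤m m (toℕ (inject₁ i)))

    back : ∀ i → arc G (x (tail i)) (x (m ∸ suc (toℕ i))) ≡ true
    back i = subst (λ s → arc G (x s) (x (m ∸ suc (toℕ i))) ≡ true) (sym (tail≡suc i))
                   (arcs P (subst (_< suc m) (tail≡suc i) (tail<1+m i)))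

    step : ∀ i → Step G (vert (inject₁ i)) (vert (suc i))
    step zero    = closing
    step (suc i) = inj₂ (back i)

    no-repeat : ∀ i j → i ≢ j → ¬ SameUse G (step i) (step j)
    no-repeat zero    zero    i≢j _  = i≢j refl
    no-repeat zero    (suc j) _   su with () ←
      trans (distinct P z<s (tail<1+m j) (sameUse-arcʳ closing _ su)) (tail≡suc j)
    no-repeat (suc i) zero    _   su with () ←
      trans (distinct P z<s (tail<1+m i) (sym (sameUse-arcˡ (back i) closing su))) (tail≡suc i)
    no-repeat (suc i) (suc j) i≢j su = i≢j (cong suc (Fin.inject₁-injective (Fin.toℕ-injective
      (∸-cancelˡ-≡ (Fin.toℕ≤pred[n] (inject₁ i)) (Fin.toℕ≤pred[n] (inject₁ j))
        (distinct P (tail<1+m i) (tail<1+m j) (sameUse-arcˡ (back i) (step (suc j)) su))))))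

module LowerBound {n} (G : MixedGraph n) (degree≡1 : ∀ u → degree G u ≡ 1)
                  (outDegree≡2 : ∀ u → outDegree G u ≡ 2) where

  partner : Fin n → Fin n
  partner u = proj₁ (countTrue≡1⇒unique (edge G u) (degree≡1 u))

  edge-partner : ∀ u → edge G u (partner u) ≡ true
  edge-partner u = proj₁ (proj₂ (countTrue≡1⇒unique (edge G u) (degree≡1 u)))

  partner-unique : ∀ {u v} → edge G u v ≡ true → v ≡ partner u
  partner-unique {u} {v} = proj₂ (proj₂ (countTrue≡1⇒unique (edge G u) (degree≡1 u))) v

  partner-involutive : ∀ u → partner (partner u) ≡ u
  partner-involutive u = sym (partner-unique (trans (edge-sym G _ _) (edge-partner u)))

  partner-injective : ∀ {u v} → partner u ≡ partner v → u ≡ v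
  partner-injective {u} {v} eq =
    trans (sym (partner-involutive u)) (trans (cong partner eq) (partner-involutive v))

  partner≢ : ∀ u → partner u ≢ u
  partner≢ u eq with () ← trans (sym (edge-irr G u)) (subst (λ v → edge G u v ≡ true) eq (edge-partner u))

  record GoodPath (m : ℕ) (w : ℕ → Fin n) : Set where
    field
      arcPath         : ArcPath {G = G} m w
      avoids-partners : ∀ {s t} → s < m → t < m → w s ≢ partner (w t)
  open GoodPath

  GoodPath-size : ∀ {m w} → GoodPath m w → 2 * m ≤ n
  GoodPath-size {m} {w} P = Fin.injective⇒≤ embed-injective
    where
    label : Fin 2 × Fin m → Fin n
    label (zero     , i) = w (toℕ i)
    label (suc zero , i) = partner (w (toℕ i))

    w∘toℕ-injective : ∀ {i j} → w (toℕ i) ≡ w (toℕ j) → i ≡ j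
    w∘toℕ-injective eq = Fin.toℕ-injective (distinct (arcPath P) (Fin.toℕ<n _) (Fin.toℕ<n _) eq)

    label-injective : ∀ x y → label x ≡ label y → x ≡ y
    label-injective (zero     , i) (zero     , j) eq = cong (zero ,_) (w∘toℕ-injective eq)
    label-injective (zero     , i) (suc zero , j) eq =
      contradiction eq (avoids-partners P (Fin.toℕ<n i) (Fin.toℕ<n j))
    label-injective (suc zero , i) (zero     , j) eq =
      contradiction (sym eq) (avoids-partners P (Fin.toℕ<n j) (Fin.toℕ<n i))
    label-injective (suc zero , i) (suc zero , j) eq = cong (suc zero ,_) (w∘toℕ-injective (partner-injective eq))

    embed-injective : ∀ {x y} → label (remQuot m x) ≡ label (remQuot m y) → x ≡ y
    embed-injective {x} {y} eq = begin
      x                                  ≡⟨ Fin.combine-remQuot m x ⟨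
      uncurry combine (remQuot {2} m x)  ≡⟨ cong (uncurry combine)
                                              (label-injective (remQuot m x) (remQuot m y) eq) ⟩
      uncurry combine (remQuot {2} m y)  ≡⟨ Fin.combine-remQuot m y ⟩
      y                                  ∎
      where open ≡-Reasoning

  Fresh : ℕ → (ℕ → Fin n) → Fin n → Set
  Fresh m w c = ∀ {t} → t < m → c ≢ w t × c ≢ partner (w t)

  GoodPath-∷ : ∀ {m w c} → GoodPath m w → arc G (w 0) c ≡ true → Fresh m w c → GoodPath (suc m) (c ∷ w)
  GoodPath-∷ {m} {w} {c} P w₀→c fresh = record
    { arcPath         = ArcPath-∷ (arcPath P) w₀→c (proj₁ ∘ fresh)
    ; avoids-partners = avoids
    }
    where
    avoids : ∀ {s t} → s < suc m → t < suc m → (c ∷ w) s ≢ partner ((c ∷ w) t)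
    avoids {zero}  {zero}  _         _         = partner≢ c ∘ sym
    avoids {zero}  {suc t} _         (s<s t<m) = proj₂ (fresh t<m)
    avoids {suc s} {zero}  (s<s s<m) _         = λ eq →
      proj₂ (fresh s<m) (trans (sym (partner-involutive c)) (cong partner (sym eq)))
    avoids {suc s} {suc t} (s<s s<m) (s<s t<m) = avoids-partners P s<m t<m

  ShortCycle : ℕ → Set
  ShortCycle m = Σ ℕ λ k → Cycle G k × k ≤ m

  classify : ∀ {j w c} → GoodPath (suc j) w → arc G (w 0) c ≡ true →
             Fresh (suc j) w c ⊎ ShortCycle (suc j) ⊎ c ≡ partner (w j)
  classify {j} {w} {c} P w₀→c with anyUpTo? (λ t → c ≟ w t) (suc j)
  ... | yes (s , s<m , refl) =
    inj₂ (inj₁ (suc s , closeArcPath (ArcPath-≤ s<m (arcPath P)) (inj₂ w₀→c) , s<m))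
  ... | no c∉w with anyUpTo? (λ t → c ≟ partner (w t)) (suc j)
  ...   | no c∉w′ = inj₁ λ t<m → (λ eq → c∉w (_ , t<m , eq)) , (λ eq → c∉w′ (_ , t<m , eq))
  ...   | yes (s , s≤j , refl) with m≤n⇒m<n∨m≡n (s≤s⁻¹ s≤j)
  ...     | inj₂ refl = inj₂ (inj₂ refl)
  ...     | inj₁ s<j  = inj₂ (inj₁ (suc (suc s) , closeArcPath cycleArcs closingEdge , s≤s s<j))
    where
    cycleArcs : ArcPath (suc (suc s)) (c ∷ w)
    cycleArcs = ArcPath-≤ (m≤n⇒m≤1+n (s≤s s<j))
                          (ArcPath-∷ (arcPath P) w₀→c λ t<m eq → c∉w (_ , t<m , eq))
    closingEdge : Step G c (w s)
    closingEdge = inj₁ (trans (edge-sym G _ _) (edge-partner (w s)))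

  extend : ∀ {j w} → GoodPath (suc j) w →
           (Σ (Fin n) λ c → GoodPath (suc (suc j)) (c ∷ w)) ⊎ ShortCycle (suc j)
  extend {j} {w} P with countTrue≡2⇒pair (arc G (w 0)) (outDegree≡2 (w 0))
  ... | a , b , a≢b , w₀→a , w₀→b with classify P w₀→a | classify P w₀→b
  ... | inj₁ fresh         | _                  = inj₁ (a , GoodPath-∷ P w₀→a fresh)
  ... | inj₂ (inj₁ short)  | _                  = inj₂ short
  ... | inj₂ (inj₂ _)      | inj₁ fresh         = inj₁ (b , GoodPath-∷ P w₀→b fresh)
  ... | inj₂ (inj₂ _)      | inj₂ (inj₁ short)  = inj₂ short
  ... | inj₂ (inj₂ a≡)     | inj₂ (inj₂ b≡)     = contradiction (trans a≡ (sym b≡)) a≢b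

  SmallCycle : Set
  SmallCycle = Σ ℕ λ k → Cycle G k × 2 * k ≤ n

  grow : Fin n → ∀ j → (Σ (ℕ → Fin n) (GoodPath (suc j))) ⊎ SmallCycle
  grow v zero = inj₁ ((λ _ → v) , record
    { arcPath         = record { arcs = λ { (s<s ()) } ; distinct = λ { z<s z<s _ → refl } }
    ; avoids-partners = λ _ _ → partner≢ v ∘ sym
    })
  grow v (suc j) with grow v j
  ... | inj₂ small = inj₂ small
  ... | inj₁ (w , P) with extend P
  ...   | inj₁ (c , P′)        = inj₁ (c ∷ w , P′)
  ...   | inj₂ (k , C , k≤1+j) = inj₂ (k , C , ≤-trans (*-monoʳ-≤ 2 k≤1+j) (GoodPath-size P))

  smallCycle : Fin n → SmallCycle
  smallCycle v with grow v n
  ... | inj₁ (_ , P) = contradiction (GoodPath-size P) (<⇒≱ (≤-trans (n<1+n n) (m≤m+n (suc n) _)))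
  ... | inj₂ small   = small

  2g≤n : ∀ {g} → HasGirth G g → 2 * g ≤ n
  2g≤n {g} (C , noShorter) with smallCycle (Cycle.vert C zero)
  ... | k , C′ , 2k≤n = ≤-trans (*-monoʳ-≤ 2 (≮⇒≥ λ k<g → noShorter k k<g C′)) 2k≤n

does⇒ : ∀ {A : Set} (a? : Dec A) → does a? ≡ true → A
does⇒ (yes a) _ = a

module Construction (g : ℕ) (1<g : 1 < g) where

  instance
    g≢0 : NonZero g
    g≢0 = >-nonZero (<-trans z<s 1<g)

  Vertex : Set
  Vertex = Fin (2 * g)

  swap : Fin 2 → Fin 2
  swap zero       = suc zero
  swap (suc zero) = zero

  swap-involutive : ∀ b → swap (swap b) ≡ b
  swap-involutive zero       = refl
  swap-involutive (suc zero) = refl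

  swap≢ : ∀ b → swap b ≢ b
  swap≢ zero       ()
  swap≢ (suc zero) ()

  layer : Vertex → Fin 2
  layer = quotient g

  index : Vertex → Fin g
  index = remainder {2} g

  vertex : Fin 2 → Fin g → Vertex
  vertex = combine

  layer-vertex : ∀ b i → layer (vertex b i) ≡ b
  layer-vertex b i = cong proj₁ (Fin.remQuot-combine b i)

  index-vertex : ∀ b i → index (vertex b i) ≡ i
  index-vertex b i = cong proj₂ (Fin.remQuot-combine b i)

  mate : Vertex → Vertex
  mate x = vertex (swap (layer x)) (index x)

  mate-involutive : ∀ x → mate (mate x) ≡ x
  mate-involutive x = begin
    vertex (swap (layer (mate x))) (index (mate x))  ≡⟨ cong₂ vertex (cong swap (layer-vertex b i))
                                                                       (index-vertex b i) ⟩
    vertex (swap (swap (layer x))) (index x)         ≡⟨ cong (λ b → vertex b i) (swap-involutive (layer x)) ⟩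
    vertex (layer x) (index x)                       ≡⟨ Fin.combine-remQuot {2} g x ⟩
    x                                                ∎
    where
    open ≡-Reasoning
    b : Fin 2
    b = swap (layer x)
    i : Fin g
    i = index x

  mate≢ : ∀ x → mate x ≢ x
  mate≢ x eq = swap≢ (layer x) (trans (sym (layer-vertex (swap (layer x)) (index x))) (cong layer eq))

  mate-sym : ∀ {x y} → y ≡ mate x → x ≡ mate y
  mate-sym {x} refl = sym (mate-involutive x)

  next : Fin g → Fin g
  next i = suc (toℕ i) mod g

  toℕ-mod : ∀ {m} → m < g → toℕ (m mod g) ≡ m
  toℕ-mod m<g = trans (Fin.toℕ-fromℕ< _) (m<n⇒m%n≡m m<g)

  next≢ : ∀ i → next i ≢ i
  next≢ i eq = <⇒≱ 1<g (∣⇒≤ ([m+n]%d≡m%d⇒d∣n (toℕ i) 1 (begin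
    (toℕ i + 1) % g  ≡⟨ cong (_% g) (+-comm (toℕ i) 1) ⟩
    suc (toℕ i) % g  ≡⟨ Fin.toℕ-fromℕ< _ ⟨
    toℕ (next i)     ≡⟨ cong toℕ eq ⟩
    toℕ i            ≡⟨ m<n⇒m%n≡m (Fin.toℕ<n i) ⟨
    toℕ i % g        ∎)))
    where open ≡-Reasoning

  G : MixedGraph (2 * g)
  G = record
    { edge     = λ x y → does (y ≟ mate x)
    ; arc      = λ x y → does (index y ≟ next (index x))
    ; edge-sym = λ x y → does-⇔ (mk⇔ mate-sym mate-sym) (y ≟ mate x) (x ≟ mate y)
    ; edge-irr = λ x → dec-false (x ≟ mate x) (mate≢ x ∘ sym)
    ; arc-irr  = λ x → dec-false (index x ≟ next (index x)) (next≢ _ ∘ sym)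
    }

  degree≡1 : ∀ x → degree G x ≡ 1
  degree≡1 x = countTrue-unique (mate x) (dec-true (mate x ≟ mate x) refl) λ y y≢ →
    dec-false (y ≟ mate x) y≢

  outDegree≡2 : ∀ x → outDegree G x ≡ 2
  outDegree≡2 x = trans (countTrue-2* (λ _ i → does (i ≟ q))) (cong₂ _+_ one one)
    where
    q : Fin g
    q = next (index x)
    one : countTrue (λ i → does (i ≟ q)) ≡ 1
    one = countTrue-unique q (dec-true (q ≟ q) refl) λ i i≢q → dec-false (i ≟ q) i≢q

  ringVertex : ℕ → Vertex
  ringVertex t = vertex zero (t mod g)

  ringVertex-arc : ∀ {t} → t < g → arc G (ringVertex t) (ringVertex (suc t)) ≡ true
  ringVertex-arc {t} t<g = dec-true (_ ≟ _) (begin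
    index (ringVertex (suc t))  ≡⟨ index-vertex zero _ ⟩
    suc t mod g                 ≡⟨ cong (λ m → suc m mod g) (toℕ-mod t<g) ⟨
    next (t mod g)              ≡⟨ cong next (index-vertex zero _) ⟨
    next (index (ringVertex t)) ∎)
    where open ≡-Reasoning

  ringVertex-injective : ∀ {s t} → s < g → t < g → ringVertex s ≡ ringVertex t → s ≡ t
  ringVertex-injective {s} {t} s<g t<g eq =
    trans (sym (toℕ-mod s<g))
          (trans (cong toℕ (Fin.combine-injectiveʳ {m = 2} zero (s mod g) zero (t mod g) eq)) (toℕ-mod t<g))

  ring : Cycle G g
  ring = record
    { nontrivial = <⇒≤ 1<g
    ; vert       = ringVertex ∘ toℕ
    ; closed     = cong (vertex zero) (Fin.toℕ-injective (begin
        toℕ (0 mod g)              ≡⟨ toℕ-mod (<-trans z<s 1<g) ⟩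
        0                          ≡⟨ n%n≡0 g ⟨
        g % g                      ≡⟨ cong (_% g) (Fin.toℕ-fromℕ g) ⟨
        toℕ (fromℕ g) % g          ≡⟨ Fin.toℕ-fromℕ< _ ⟨
        toℕ (toℕ (fromℕ g) mod g)  ∎))
    ; step       = λ i → inj₂ (subst (λ s → arc G (ringVertex s) (ringVertex (suc (toℕ i))) ≡ true)
                                     (sym (Fin.toℕ-inject₁ i)) (ringVertex-arc (Fin.toℕ<n i)))
    ; no-repeat  = λ i j i≢j (same , _) → i≢j (Fin.inject₁-injective (Fin.toℕ-injective
                     (ringVertex-injective (inject₁<g i) (inject₁<g j) same)))
    }
    where
    open ≡-Reasoning
    inject₁<g : ∀ (i : Fin g) → toℕ (inject₁ i) < g
    inject₁<g i = subst (_< g) (sym (Fin.toℕ-inject₁ i)) (Fin.toℕ<n i)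

  index-edge : ∀ {x y} → edge G x y ≡ true → toℕ (index y) ≡ toℕ (index x)
  index-edge {x} h =
    trans (cong (toℕ ∘ index) (does⇒ (_ ≟ mate x) h)) (cong toℕ (index-vertex (swap (layer x)) (index x)))

  index-arc : ∀ {x y} → arc G x y ≡ true → toℕ (index y) % g ≡ suc (toℕ (index x)) % g
  index-arc {x} {y} h = trans (m<n⇒m%n≡m (Fin.toℕ<n _))
    (trans (cong toℕ (does⇒ (index y ≟ _) h)) (Fin.toℕ-fromℕ< _))

  matching : ∀ {u v w} → edge G u v ≡ true → edge G u w ≡ true → v ≡ w
  matching {u} {v} {w} h h′ = trans (does⇒ (v ≟ mate u) h) (sym (does⇒ (w ≟ mate u) h′))

  g≤arcCount : ∀ {k} (C : Cycle G k) → g ≤ arcCount C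
  g≤arcCount C =
    ∣⇒≤ {{≢-nonZero (arcCount≢0 matching C)}} (d∣arcCount (toℕ ∘ index) g index-edge index-arc C)

  girth : HasGirth G g
  girth = ring , λ k k<g C → <⇒≱ (≤-<-trans (arcCount≤length C) k<g) (g≤arcCount C)

-- The argument only needs 2 ≤ g.
mainTheorem2 : ∀ (g : ℕ) → 5 ≤ g → MinOrder 1 2 g (2 * g)
mainTheorem2 g 5≤g = (G , degree≡1 , outDegree≡2 , girth) , lowerBound
  where
  open Construction g (≤-trans (s≤s (s≤s z≤n)) 5≤g)
  lowerBound : ∀ n (H : MixedGraph n) → IsRZGGraph H 1 2 g → 2 * g ≤ n
  lowerBound n H (deg , out , girthH) = LowerBound.2g≤n H deg out girthH
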